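{- Let $a \in \mathbb{Z}^n$ be non-zero, $b\in\mathbb{Z}$, $\Delta=\lVert a\rVert_\infty$, and let $\mathcal{P}_I = \operatorname{Conv}(\{x\in\mathbb{R}^n : a^\top x = b,\ x\ge 0\}\cap\mathbb{Z}^n)$. For every vertex $v$ of $\mathcal{P}_I$ with $|\operatorname{supp}(v)|=s$ we have $s \le \log(3.51\cdot\sqrt{s}\cdot\Delta)$.
   Context: All logarithms are base 2. $\operatorname{supp}(v)=\{i: v_i\neq 0\}$. A vertex of $\mathcal{P}_I$ is a point $v\in\mathcal{P}_I$ with $v\notin\operatorname{Conv}(\mathcal{P}_I\setminus\{v\})$. -}

module Defs where

open import Data.Nat as ℕ using (ℕ; zero; suc; _⊔_)
open import Data.Integer as ℤ using (ℤ; +_; ∣_∣)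
open import Data.Rational as ℚ using (ℚ; 0ℚ; 1ℚ; _/_)
open import Data.Rational.Properties using (_≟_)
open import Data.Fin using (Fin; zero; suc)
open import Data.Product using (Σ; ∃; _×_)
open import Relation.Nullary using (¬_; yes; no)
open import Relation.Binary.PropositionalEquality using (_≡_)

sumℤ : {m : ℕ} → (Fin m → ℤ) → ℤ
sumℤ {zero}  f = + 0
sumℤ {suc m} f = f zero ℤ.+ sumℤ (λ j → f (suc j))

sumℚ : {m : ℕ} → (Fin m → ℚ) → ℚ
sumℚ {zero}  f = 0ℚ
sumℚ {suc m} f = f zero ℚ.+ sumℚ (λ j → f (suc j))

normInf : {n : ℕ} → (Fin n → ℤ) → ℕ
normInf {zero}  a = 0
normInf {suc n} a = ∣ a zero ∣ ⊔ normInf (λ i → a (suc i))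

suppSize : {n : ℕ} → (Fin n → ℚ) → ℕ
suppSize {zero}  v = 0
suppSize {suc n} v with v zero ≟ 0ℚ
... | yes _ = suppSize (λ i → v (suc i))
... | no  _ = suc (suppSize (λ i → v (suc i)))

toℚ : ℤ → ℚ
toℚ z = z / 1

IntFeasible : {n : ℕ} → (Fin n → ℤ) → ℤ → (Fin n → ℚ) → Set
IntFeasible {n} a b x =
  Σ (Fin n → ℤ) λ z →
    (∀ i → x i ≡ toℚ (z i)) ×
    (∀ i → + 0 ℤ.≤ z i) ×
    (sumℤ (λ i → a i ℤ.* z i) ≡ b)

InConv : {n : ℕ} → ((Fin n → ℚ) → Set) → (Fin n → ℚ) → Set
InConv {n} S x =
  Σ ℕ λ m → Σ (Fin m → ℚ) λ c → Σ (Fin m → Fin n → ℚ) λ p →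
    (∀ j → 0ℚ ℚ.≤ c j) ×
    (sumℚ c ≡ 1ℚ) ×
    (∀ j → S (p j)) ×
    (∀ i → x i ≡ sumℚ (λ j → c j ℚ.* p j i))

PI : {n : ℕ} → (Fin n → ℤ) → ℤ → (Fin n → ℚ) → Set
PI a b = InConv (IntFeasible a b)

IsVertex : {n : ℕ} → (Fin n → ℤ) → ℤ → (Fin n → ℚ) → Set
IsVertex a b v =
  PI a b v × ¬ InConv (λ y → PI a b y × ¬ (∀ i → y i ≡ v i)) v

{-# OPTIONS --safe #-}
module Submission where

-- A vertex v of P_I is an integer point z, and for no nonzero d ∈ {-1,0,1}ⁿ supported on supp(v)
-- can aᵀd = 0, since then v would be the midpoint of the integer points z ± d of P_I. Hence the
-- 2^s subset sums x_T = Σ_{i∈T} aᵢ (T ⊆ supp v, s = |supp v|) are pairwise distinct integers.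
-- With A = Σ_{i∈supp v} aᵢ, expanding squares gives Σ_T (2x_T − A)² = 2^s Σ_{i∈supp v} aᵢ² ≤ 2^s s Δ².
-- On the other hand at most K of the distinct x_T satisfy |2x_T − A| < K, so the left side is at
-- least K²(2^s − K); taking K = 2^(s−1) yields 4^s ≤ 8 s Δ², which is stronger than the claim
-- since 8 < 3.51² = 12.3201.

open import Defs
open import Data.Nat using (ℕ; zero; suc; _+_; _*_; _^_; _∸_; _≤_; _<_; z≤n; s≤s)
import Data.Nat.Properties as ℕP
import Data.Nat.Tactic.RingSolver as ℕSolver
open import Data.Nat.ListAction using (sum)
open import Data.Nat.ListAction.Properties using (sum-++)
open import Data.Integer as ℤ using (ℤ; 0ℤ)
import Data.Integer.Properties as ℤP
import Data.Integer.Tactic.RingSolver as ℤSolver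
open import Data.Integer.DivMod using (_/ℕ_; _%ℕ_; a≡a%ℕn+[a/ℕn]*n; n%ℕd<d)
open import Algebra.Properties.AbelianGroup ℤP.+-0-abelianGroup using () renaming (∙-cancelˡ to +-cancelˡ)
open import Data.Rational as ℚ using (ℚ)
import Data.Rational.Properties as ℚP
import Data.Rational.Unnormalised as ℚᵘ
import Data.Rational.Unnormalised.Properties as ℚᵘP
open import Data.Rational.Solver using (module +-*-Solver)
open import Data.Fin using (Fin; zero; suc)
open import Data.Fin.Properties using (any?; all?)
import Data.Vec.Functional as Vec
open import Data.List using (List; []; _∷_; _++_; map; foldr; length; filter)
open import Data.List.Properties using (map-++; length-++; length-map; filter-accept; filter-reject; filter-all)
open import Data.List.Membership.Propositional using (_∈_)
open import Data.List.Membership.Propositional.Properties using (∈-++⁻; ∈-map⁻)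
open import Data.List.Relation.Unary.Any using (here)
open import Data.List.Relation.Unary.All as All using (All; []; _∷_)
import Data.List.Relation.Unary.All.Properties as AllP
open import Data.List.Relation.Unary.AllPairs using ([]; _∷_)
open import Data.List.Relation.Unary.Unique.Propositional using (Unique)
import Data.List.Relation.Unary.Unique.Propositional.Properties as UniqueP
open import Data.Product using (∃; _×_; _,_; proj₁; proj₂)
open import Data.Sum using (_⊎_; inj₁; inj₂)
open import Data.Empty using (⊥; ⊥-elim)
open import Function using (_∘_)
open import Relation.Nullary using (¬_; Dec; yes; no; ¬?)
open import Relation.Binary.Definitions using (_Respects_)
open import Relation.Binary.PropositionalEquality
  using (_≡_; _≢_; _≗_; refl; sym; trans; cong; cong₂; subst; module ≡-Reasoning)

-- toℚ x is fromℚᵘ (mkℚᵘ x 0) on the nose, so facts about ℤ ↪ ℚ are transported from ℚᵘ.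
toℚᵘ-toℚ : ∀ x → ℚ.toℚᵘ (toℚ x) ℚᵘ.≃ ℚᵘ.mkℚᵘ x 0
toℚᵘ-toℚ x = ℚP.toℚᵘ-fromℚᵘ (ℚᵘ.mkℚᵘ x 0)

toℚ-injective : ∀ {x y} → toℚ x ≡ toℚ y → x ≡ y
toℚ-injective {x} {y} eq with ℚP.fromℚᵘ-injective {ℚᵘ.mkℚᵘ x 0} {ℚᵘ.mkℚᵘ y 0} eq
... | ℚᵘ.*≡* x*1≡y*1 = trans (sym (ℤP.*-identityʳ x)) (trans x*1≡y*1 (ℤP.*-identityʳ y))

toℚ-+ : ∀ x y → toℚ (x ℤ.+ y) ≡ toℚ x ℚ.+ toℚ y
toℚ-+ x y = ℚP.toℚᵘ-injective (begin
  ℚ.toℚᵘ (toℚ (x ℤ.+ y))                ≈⟨ toℚᵘ-toℚ (x ℤ.+ y) ⟩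
  ℚᵘ.mkℚᵘ (x ℤ.+ y) 0                    ≈⟨ ℚᵘ.*≡* (scale x y) ⟩
  ℚᵘ.mkℚᵘ x 0 ℚᵘ.+ ℚᵘ.mkℚᵘ y 0           ≈⟨ ℚᵘP.+-cong (toℚᵘ-toℚ x) (toℚᵘ-toℚ y) ⟨
  ℚ.toℚᵘ (toℚ x) ℚᵘ.+ ℚ.toℚᵘ (toℚ y)     ≈⟨ ℚP.toℚᵘ-homo-+ (toℚ x) (toℚ y) ⟨
  ℚ.toℚᵘ (toℚ x ℚ.+ toℚ y)               ∎)
  where
  open ℚᵘP.≃-Reasoning
  scale : ∀ x y → (x ℤ.+ y) ℤ.* ℤ.+ 1 ≡ (x ℤ.* ℤ.+ 1 ℤ.+ y ℤ.* ℤ.+ 1) ℤ.* ℤ.+ 1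
  scale = ℤSolver.solve-∀

toℚ-neg : ∀ x → toℚ (ℤ.- x) ≡ ℚ.- toℚ x
toℚ-neg x = ℚP.toℚᵘ-injective (begin
  ℚ.toℚᵘ (toℚ (ℤ.- x))   ≈⟨ toℚᵘ-toℚ (ℤ.- x) ⟩
  ℚᵘ.mkℚᵘ (ℤ.- x) 0       ≈⟨ ℚᵘP.-‿cong (toℚᵘ-toℚ x) ⟨
  ℚᵘ.- ℚ.toℚᵘ (toℚ x)     ≈⟨ ℚP.toℚᵘ-homo‿- (toℚ x) ⟨
  ℚ.toℚᵘ (ℚ.- toℚ x)      ∎)
  where open ℚᵘP.≃-Reasoning

IsExtreme : ∀ {n} → ((Fin n → ℚ) → Set) → (Fin n → ℚ) → Set
IsExtreme P v = P v × ¬ InConv (λ y → P y × ¬ y ≗ v) v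

∈⇒∈-conv : ∀ {n} {S : (Fin n → ℚ) → Set} {x} → S x → InConv S x
∈⇒∈-conv {x = x} x∈S =
  1 , (λ _ → ℚ.1ℚ) , (λ _ → x) , (λ _ → ℚ.*≤* (ℤ.+≤+ z≤n)) , refl , (λ _ → x∈S) ,
  λ i → sym (trans (ℚP.+-identityʳ _) (ℚP.*-identityˡ (x i)))

extreme-conv⇒∈ : ∀ {n} {S : (Fin n → ℚ) → Set} {v} → S Respects _≗_ → IsExtreme (InConv S) v → S v
extreme-conv⇒∈ {S = S} {v} resp ((m , c , p , c≥0 , Σc≡1 , p∈S , v≡Σcp) , v∉conv)
  with any? (λ j → all? (λ i → p j i ℚP.≟ v i))
... | yes (j , pⱼ≗v) = resp pⱼ≗v (p∈S j)
... | no ∄j = ⊥-elim (v∉conv (m , c , p , c≥0 , Σc≡1 , p∈conv∖v , v≡Σcp))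
  where
  p∈conv∖v : ∀ j → InConv S (p j) × ¬ p j ≗ v
  p∈conv∖v j = ∈⇒∈-conv {S = S} (p∈S j) , λ pⱼ≗v → ∄j (j , pⱼ≗v)

½ : ℚ
½ = ℤ.+ 1 ℚ./ 2

extreme-midpoint : ∀ {n} {P : (Fin n → ℚ) → Set} {v p q} → IsExtreme P v → P p → P q →
                   (∀ i → v i ≡ ½ ℚ.* p i ℚ.+ ½ ℚ.* q i) → ¬ p ≗ v → ¬ q ≗ v → ⊥
extreme-midpoint {n} {P} {v} {p} {q} (_ , v∉conv) p∈P q∈P v≡mid p≉v q≉v =
  v∉conv (2 , (λ _ → ½) , ends , (λ _ → ℚ.*≤* (ℤ.+≤+ z≤n)) , refl , ends∈P∖v ,
          λ i → trans (v≡mid i) (cong (ℚ._+_ (½ ℚ.* p i)) (sym (ℚP.+-identityʳ _))))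
  where
  ends : Fin 2 → Fin n → ℚ
  ends zero    = p
  ends (suc _) = q
  ends∈P∖v : ∀ j → P (ends j) × ¬ ends j ≗ v
  ends∈P∖v zero       = p∈P , p≉v
  ends∈P∖v (suc zero) = q∈P , q≉v

infix 7 _∙_
_∙_ : ∀ {n} → (Fin n → ℤ) → (Fin n → ℤ) → ℤ
a ∙ x = sumℤ (λ i → a i ℤ.* x i)

∙-distribˡ-+ : ∀ {n} (a x y : Fin n → ℤ) → a ∙ (λ i → x i ℤ.+ y i) ≡ a ∙ x ℤ.+ a ∙ y
∙-distribˡ-+ {zero}  a x y = refl
∙-distribˡ-+ {suc n} a x y =
  trans (cong (ℤ._+_ (a zero ℤ.* (x zero ℤ.+ y zero))) (∙-distribˡ-+ (a ∘ suc) (x ∘ suc) (y ∘ suc)))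
        (distrib (a zero) (x zero) (y zero) ((a ∘ suc) ∙ (x ∘ suc)) ((a ∘ suc) ∙ (y ∘ suc)))
  where
  distrib : ∀ a₀ x₀ y₀ X Y → a₀ ℤ.* (x₀ ℤ.+ y₀) ℤ.+ (X ℤ.+ Y) ≡
                             (a₀ ℤ.* x₀ ℤ.+ X) ℤ.+ (a₀ ℤ.* y₀ ℤ.+ Y)
  distrib = ℤSolver.solve-∀

∙-negʳ : ∀ {n} (a x : Fin n → ℤ) → a ∙ (ℤ.-_ ∘ x) ≡ ℤ.- (a ∙ x)
∙-negʳ {zero}  a x = refl
∙-negʳ {suc n} a x =
  trans (cong (ℤ._+_ (a zero ℤ.* ℤ.- x zero)) (∙-negʳ (a ∘ suc) (x ∘ suc)))
        (negate (a zero) (x zero) ((a ∘ suc) ∙ (x ∘ suc)))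
  where
  negate : ∀ a₀ x₀ X → a₀ ℤ.* ℤ.- x₀ ℤ.+ ℤ.- X ≡ ℤ.- (a₀ ℤ.* x₀ ℤ.+ X)
  negate = ℤSolver.solve-∀

∙-0∷ : ∀ {n} (a : Fin (suc n) → ℤ) e → a ∙ (0ℤ Vec.∷ e) ≡ (a ∘ suc) ∙ e
∙-0∷ a e = trans (cong (ℤ._+ (a ∘ suc) ∙ e) (ℤP.*-zeroʳ (a zero))) (ℤP.+-identityˡ _)

∙-1∷ : ∀ {n} (a : Fin (suc n) → ℤ) e → a ∙ (ℤ.+ 1 Vec.∷ e) ≡ a zero ℤ.+ (a ∘ suc) ∙ e
∙-1∷ a e = cong (ℤ._+ (a ∘ suc) ∙ e) (ℤP.*-identityʳ (a zero))

IsSubsetIndicator : ∀ {n} → (Fin n → ℚ) → (Fin n → ℤ) → Set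
IsSubsetIndicator v e = ∀ i → e i ≡ 0ℤ ⊎ (v i ≢ ℚ.0ℚ × e i ≡ ℤ.+ 1)

0∷-isSubsetIndicator : ∀ {n} {v : Fin (suc n) → ℚ} {e} →
                       IsSubsetIndicator (v ∘ suc) e → IsSubsetIndicator v (0ℤ Vec.∷ e)
0∷-isSubsetIndicator ind zero    = inj₁ refl
0∷-isSubsetIndicator ind (suc i) = ind i

1∷-isSubsetIndicator : ∀ {n} {v : Fin (suc n) → ℚ} {e} → v zero ≢ ℚ.0ℚ →
                       IsSubsetIndicator (v ∘ suc) e → IsSubsetIndicator v (ℤ.+ 1 Vec.∷ e)
1∷-isSubsetIndicator v₀≢0 ind zero    = inj₂ (v₀≢0 , refl)
1∷-isSubsetIndicator v₀≢0 ind (suc i) = ind i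

SubsetSumsInjective : ∀ {n} → (Fin n → ℤ) → (Fin n → ℚ) → Set
SubsetSumsInjective a v =
  ∀ {e₁ e₂} → IsSubsetIndicator v e₁ → IsSubsetIndicator v e₂ → a ∙ e₁ ≡ a ∙ e₂ → e₁ ≗ e₂

subsetSumsInjective-tail : ∀ {n} {a : Fin (suc n) → ℤ} {v} →
                           SubsetSumsInjective a v → SubsetSumsInjective (a ∘ suc) (v ∘ suc)
subsetSumsInjective-tail {a = a} inj {e₁} {e₂} ind₁ ind₂ eq i =
  inj (0∷-isSubsetIndicator ind₁) (0∷-isSubsetIndicator ind₂)
      (trans (∙-0∷ a e₁) (trans eq (sym (∙-0∷ a e₂)))) (suc i)

x+y≡x⇒y≡0 : ∀ x y → x ℤ.+ y ≡ x → y ≡ 0ℤ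
x+y≡x⇒y≡0 x y eq = +-cancelˡ x y 0ℤ (trans eq (sym (ℤP.+-identityʳ x)))

indicator-bounds : ∀ {q z e} → 0ℤ ℤ.≤ z → q ≡ toℚ z → e ≡ 0ℤ ⊎ (q ≢ ℚ.0ℚ × e ≡ ℤ.+ 1) →
                   0ℤ ℤ.≤ e × e ℤ.≤ z
indicator-bounds z≥0 q≡z (inj₁ refl)          = ℤP.≤-refl , z≥0
indicator-bounds z≥0 q≡z (inj₂ (q≢0 , refl)) =
  ℤ.+≤+ z≤n , ℤP.i<j⇒suc[i]≤j (ℤP.≤∧≢⇒< z≥0 (λ 0≡z → q≢0 (trans q≡z (cong toℚ (sym 0≡z)))))

perturbation-nonneg : ∀ {w x y} → 0ℤ ℤ.≤ x × x ℤ.≤ w → 0ℤ ℤ.≤ y × y ℤ.≤ w →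
                      0ℤ ℤ.≤ w ℤ.+ (x ℤ.- y) × 0ℤ ℤ.≤ w ℤ.- (x ℤ.- y)
perturbation-nonneg {w} {x} {y} (0≤x , x≤w) (0≤y , y≤w) =
  subst (0ℤ ℤ.≤_) (plus w x y) (ℤP.+-mono-≤ (ℤP.i≤j⇒0≤j-i y≤w) 0≤x) ,
  subst (0ℤ ℤ.≤_) (minus w x y) (ℤP.+-mono-≤ (ℤP.i≤j⇒0≤j-i x≤w) 0≤y)
  where
  plus : ∀ w x y → (w ℤ.- y) ℤ.+ x ≡ w ℤ.+ (x ℤ.- y)
  plus = ℤSolver.solve-∀
  minus : ∀ w x y → (w ℤ.- x) ℤ.+ y ≡ w ℤ.- (x ℤ.- y)
  minus = ℤSolver.solve-∀

module _ {n : ℕ} (a : Fin n → ℤ) (b : ℤ) where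

  IntFeasible-respects-≗ : IntFeasible a b Respects _≗_
  IntFeasible-respects-≗ x≗y (z , x≗z , z≥0 , az≡b) = z , (λ i → trans (sym (x≗y i)) (x≗z i)) , z≥0 , az≡b

  vertex⇒intFeasible : ∀ {v} → IsVertex a b v → IntFeasible a b v
  vertex⇒intFeasible = extreme-conv⇒∈ IntFeasible-respects-≗

  integral⇒∈PI : ∀ w → (∀ i → 0ℤ ℤ.≤ w i) → a ∙ w ≡ b → PI a b (toℚ ∘ w)
  integral⇒∈PI w w≥0 aw≡b = ∈⇒∈-conv {S = IntFeasible a b} (w , (λ _ → refl) , w≥0 , aw≡b)

  vertex-rigid : ∀ {v} z → IsVertex a b v → (∀ i → v i ≡ toℚ (z i)) → a ∙ z ≡ b →
                 ∀ d → (∀ i → 0ℤ ℤ.≤ z i ℤ.+ d i) → (∀ i → 0ℤ ℤ.≤ z i ℤ.- d i) → a ∙ d ≡ 0ℤ →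
                 ∀ i → d i ≡ 0ℤ
  vertex-rigid {v} z vertex v≗z az≡b d z+d≥0 z-d≥0 ad≡0 i with d i ℤP.≟ 0ℤ
  ... | yes dᵢ≡0 = dᵢ≡0
  ... | no dᵢ≢0 = ⊥-elim (extreme-midpoint vertex
    (integral⇒∈PI z+d z+d≥0 a[z+d]≡b) (integral⇒∈PI z-d z-d≥0 a[z-d]≡b) midpoint
    (λ z+d≗v → dᵢ≢0 (x+y≡x⇒y≡0 (z i) (d i) (toℚ-injective (trans (z+d≗v i) (v≗z i)))))
    (λ z-d≗v → dᵢ≢0 (ℤP.neg-injective
                       (x+y≡x⇒y≡0 (z i) (ℤ.- d i) (toℚ-injective (trans (z-d≗v i) (v≗z i)))))))
    where
    z+d z-d : Fin n → ℤ
    z+d j = z j ℤ.+ d j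
    z-d j = z j ℤ.- d j
    a[z+d]≡b : a ∙ z+d ≡ b
    a[z+d]≡b = trans (∙-distribˡ-+ a z d) (trans (cong₂ ℤ._+_ az≡b ad≡0) (ℤP.+-identityʳ b))
    a[z-d]≡b : a ∙ z-d ≡ b
    a[z-d]≡b = trans (∙-distribˡ-+ a z (ℤ.-_ ∘ d))
                     (trans (cong₂ ℤ._+_ az≡b (trans (∙-negʳ a d) (cong ℤ.-_ ad≡0))) (ℤP.+-identityʳ b))
    halves : ∀ Z D → Z ≡ ½ ℚ.* (Z ℚ.+ D) ℚ.+ ½ ℚ.* (Z ℚ.+ ℚ.- D)
    halves = +-*-Solver.solve 2 (λ Z D → Z := con ½ :* (Z :+ D) :+ con ½ :* (Z :+ :- D)) refl
      where open +-*-Solver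
    midpoint : ∀ j → v j ≡ ½ ℚ.* toℚ (z+d j) ℚ.+ ½ ℚ.* toℚ (z-d j)
    midpoint j = begin
      v j                                                       ≡⟨ v≗z j ⟩
      toℚ (z j)                                                 ≡⟨ halves (toℚ (z j)) (toℚ (d j)) ⟩
      ½ ℚ.* (toℚ (z j) ℚ.+ toℚ (d j)) ℚ.+ ½ ℚ.* (toℚ (z j) ℚ.+ ℚ.- toℚ (d j))
        ≡⟨ cong₂ (λ p q → ½ ℚ.* p ℚ.+ ½ ℚ.* q)
                 (sym (toℚ-+ (z j) (d j)))
                 (trans (cong (toℚ (z j) ℚ.+_) (sym (toℚ-neg (d j)))) (sym (toℚ-+ (z j) (ℤ.- d j)))) ⟩
      ½ ℚ.* toℚ (z+d j) ℚ.+ ½ ℚ.* toℚ (z-d j)                   ∎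
      where open ≡-Reasoning

  vertex⇒subsetSumsInjective : ∀ {v} → IsVertex a b v → SubsetSumsInjective a v
  vertex⇒subsetSumsInjective {v} vertex {e₁} {e₂} ind₁ ind₂ ae₁≡ae₂ i with vertex⇒intFeasible vertex
  ... | z , v≗z , z≥0 , az≡b =
    ℤP.i-j≡0⇒i≡j (e₁ i) (e₂ i)
      (vertex-rigid z vertex v≗z az≡b d (proj₁ ∘ z±d≥0) (proj₂ ∘ z±d≥0) ad≡0 i)
    where
    d : Fin n → ℤ
    d j = e₁ j ℤ.- e₂ j
    bounds : ∀ {e} → IsSubsetIndicator v e → ∀ j → 0ℤ ℤ.≤ e j × e j ℤ.≤ z j
    bounds ind j = indicator-bounds (z≥0 j) (v≗z j) (ind j)
    z±d≥0 : ∀ j → 0ℤ ℤ.≤ z j ℤ.+ d j × 0ℤ ℤ.≤ z j ℤ.- d j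
    z±d≥0 j = perturbation-nonneg (bounds ind₁ j) (bounds ind₂ j)
    ad≡0 : a ∙ d ≡ 0ℤ
    ad≡0 = trans (∙-distribˡ-+ a e₁ (ℤ.-_ ∘ e₂))
                 (trans (cong (ℤ._+_ (a ∙ e₁)) (∙-negʳ a e₂)) (ℤP.i≡j⇒i-j≡0 ae₁≡ae₂))

entriesOnSupp : ∀ {n} → (Fin n → ℤ) → (Fin n → ℚ) → List ℤ
entriesOnSupp {zero}  a v = []
entriesOnSupp {suc n} a v with v zero ℚP.≟ ℚ.0ℚ
... | yes _ = entriesOnSupp (a ∘ suc) (v ∘ suc)
... | no _  = a zero ∷ entriesOnSupp (a ∘ suc) (v ∘ suc)

length-entriesOnSupp : ∀ {n} (a : Fin n → ℤ) v → length (entriesOnSupp a v) ≡ suppSize v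
length-entriesOnSupp {zero}  a v = refl
length-entriesOnSupp {suc n} a v with v zero ℚP.≟ ℚ.0ℚ
... | yes _ = length-entriesOnSupp (a ∘ suc) (v ∘ suc)
... | no _  = cong suc (length-entriesOnSupp (a ∘ suc) (v ∘ suc))

normInf-tail≤ : ∀ {n} (a : Fin (suc n) → ℤ) → normInf (a ∘ suc) ≤ normInf a
normInf-tail≤ a = ℕP.m≤n⊔m ℤ.∣ a zero ∣ (normInf (a ∘ suc))

entriesOnSupp-bounded : ∀ {n} (a : Fin n → ℤ) v → All (λ h → ℤ.∣ h ∣ ≤ normInf a) (entriesOnSupp a v)
entriesOnSupp-bounded {zero}  a v = []
entriesOnSupp-bounded {suc n} a v with v zero ℚP.≟ ℚ.0ℚ
... | yes _ = All.map (λ h≤ → ℕP.≤-trans h≤ (normInf-tail≤ a)) (entriesOnSupp-bounded (a ∘ suc) (v ∘ suc))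
... | no _  = ℕP.m≤m⊔n _ _ ∷
              All.map (λ h≤ → ℕP.≤-trans h≤ (normInf-tail≤ a)) (entriesOnSupp-bounded (a ∘ suc) (v ∘ suc))

subsetSums : List ℤ → List ℤ
subsetSums []       = 0ℤ ∷ []
subsetSums (h ∷ hs) = subsetSums hs ++ map (ℤ._+_ h) (subsetSums hs)

length-subsetSums : ∀ hs → length (subsetSums hs) ≡ 2 ^ length hs
length-subsetSums []       = refl
length-subsetSums (h ∷ hs) = begin
  length (L ++ map (ℤ._+_ h) L)          ≡⟨ length-++ L ⟩
  length L + length (map (ℤ._+_ h) L)    ≡⟨ cong (length L +_) (length-map _ L) ⟩
  length L + length L                    ≡⟨ cong (λ m → m + m) (length-subsetSums hs) ⟩
  2 ^ length hs + 2 ^ length hs          ≡⟨ cong (2 ^ length hs +_) (ℕP.+-identityʳ _) ⟨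
  2 ^ length hs + (2 ^ length hs + 0)    ∎
  where
  open ≡-Reasoning
  L = subsetSums hs

∈-subsetSums⁻ : ∀ {n} (a : Fin n → ℤ) v {x} → x ∈ subsetSums (entriesOnSupp a v) →
                ∃ λ e → IsSubsetIndicator v e × a ∙ e ≡ x
∈-subsetSums⁻ {zero}  a v (here refl) = (λ ()) , (λ ()) , refl
∈-subsetSums⁻ {suc n} a v x∈ with v zero ℚP.≟ ℚ.0ℚ
... | yes _ with ∈-subsetSums⁻ (a ∘ suc) (v ∘ suc) x∈
...   | e , ind , ae≡x = 0ℤ Vec.∷ e , 0∷-isSubsetIndicator ind , trans (∙-0∷ a e) ae≡x
∈-subsetSums⁻ {suc n} a v x∈ | no v₀≢0 with ∈-++⁻ (subsetSums (entriesOnSupp (a ∘ suc) (v ∘ suc))) x∈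
...   | inj₁ x∈L with ∈-subsetSums⁻ (a ∘ suc) (v ∘ suc) x∈L
...     | e , ind , ae≡x = 0ℤ Vec.∷ e , 0∷-isSubsetIndicator ind , trans (∙-0∷ a e) ae≡x
∈-subsetSums⁻ {suc n} a v x∈ | no v₀≢0 | inj₂ x∈a₀+L with ∈-map⁻ (ℤ._+_ (a zero)) x∈a₀+L
...   | y , y∈L , refl with ∈-subsetSums⁻ (a ∘ suc) (v ∘ suc) y∈L
...     | e , ind , refl = ℤ.+ 1 Vec.∷ e , 1∷-isSubsetIndicator v₀≢0 ind , ∙-1∷ a e

subsetSums-unique : ∀ {n} (a : Fin n → ℤ) v → SubsetSumsInjective a v → Unique (subsetSums (entriesOnSupp a v))
subsetSums-unique {zero}  a v inj = [] ∷ []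
subsetSums-unique {suc n} a v inj with v zero ℚP.≟ ℚ.0ℚ
... | yes _   = subsetSums-unique (a ∘ suc) (v ∘ suc) (subsetSumsInjective-tail {a = a} inj)
... | no v₀≢0 = UniqueP.++⁺ unique (UniqueP.map⁺ (+-cancelˡ (a zero) _ _) unique) disjoint
  where
  L = subsetSums (entriesOnSupp (a ∘ suc) (v ∘ suc))
  unique : Unique L
  unique = subsetSums-unique (a ∘ suc) (v ∘ suc) (subsetSumsInjective-tail {a = a} inj)
  disjoint : ∀ {x} → ¬ (x ∈ L × x ∈ map (ℤ._+_ (a zero)) L)
  disjoint (x∈L , x∈a₀+L) with ∈-map⁻ (ℤ._+_ (a zero)) x∈a₀+L
  ... | y , y∈L , refl with ∈-subsetSums⁻ (a ∘ suc) (v ∘ suc) x∈L | ∈-subsetSums⁻ (a ∘ suc) (v ∘ suc) y∈L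
  ... | e₁ , ind₁ , ae₁≡x | e₂ , ind₂ , refl
    with inj (0∷-isSubsetIndicator ind₁) (1∷-isSubsetIndicator v₀≢0 ind₂)
             (trans (∙-0∷ a e₁) (trans ae₁≡x (sym (∙-1∷ a e₂)))) zero
  ... | ()

∣_∣² : ℤ → ℕ
∣ x ∣² = ℤ.∣ x ∣ ^ 2

+∣_∣²≡square : ∀ x → ℤ.+ ∣ x ∣² ≡ x ℤ.* x
+∣ x ∣²≡square = trans (cong (λ m → ℤ.+ (ℤ.∣ x ∣ * m)) (ℕP.*-identityʳ ℤ.∣ x ∣)) (+∣x∣*∣x∣ x)
  where
  +∣x∣*∣x∣ : ∀ x → ℤ.+ (ℤ.∣ x ∣ * ℤ.∣ x ∣) ≡ x ℤ.* x
  +∣x∣*∣x∣ (ℤ.+ m)    = ℤP.pos-* m m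
  +∣x∣*∣x∣ ℤ.-[1+ m ] = refl

parallelogram : ∀ y h → ∣ y ℤ.- h ∣² + ∣ y ℤ.+ h ∣² ≡ 2 * ∣ y ∣² + 2 * ∣ h ∣²
parallelogram y h = ℤP.+-injective (begin
  ℤ.+ ∣ y ℤ.- h ∣² ℤ.+ ℤ.+ ∣ y ℤ.+ h ∣²
    ≡⟨ cong₂ ℤ._+_ +∣ y ℤ.- h ∣²≡square +∣ y ℤ.+ h ∣²≡square ⟩
  (y ℤ.- h) ℤ.* (y ℤ.- h) ℤ.+ (y ℤ.+ h) ℤ.* (y ℤ.+ h)
    ≡⟨ law y h ⟩
  ℤ.+ 2 ℤ.* (y ℤ.* y) ℤ.+ ℤ.+ 2 ℤ.* (h ℤ.* h)
    ≡⟨ cong₂ (λ p q → ℤ.+ 2 ℤ.* p ℤ.+ ℤ.+ 2 ℤ.* q) +∣ y ∣²≡square +∣ h ∣²≡square ⟨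
  ℤ.+ 2 ℤ.* ℤ.+ ∣ y ∣² ℤ.+ ℤ.+ 2 ℤ.* ℤ.+ ∣ h ∣²
    ≡⟨ cong₂ ℤ._+_ (ℤP.pos-* 2 ∣ y ∣²) (ℤP.pos-* 2 ∣ h ∣²) ⟨
  ℤ.+ (2 * ∣ y ∣² + 2 * ∣ h ∣²)
    ∎)
  where
  open ≡-Reasoning
  law : ∀ y h → (y ℤ.- h) ℤ.* (y ℤ.- h) ℤ.+ (y ℤ.+ h) ℤ.* (y ℤ.+ h) ≡
                ℤ.+ 2 ℤ.* (y ℤ.* y) ℤ.+ ℤ.+ 2 ℤ.* (h ℤ.* h)
  law = ℤSolver.solve-∀

energy : ℤ → List ℤ → ℕ
energy c xs = sum (map (λ x → ∣ x ℤ.+ x ℤ.- c ∣²) xs)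

energy-++ : ∀ c xs ys → energy c (xs ++ ys) ≡ energy c xs + energy c ys
energy-++ c xs ys = trans (cong sum (map-++ _ xs ys)) (sum-++ (map _ xs) _)

energy-shift : ∀ h c xs → energy (h ℤ.+ c) xs + energy (h ℤ.+ c) (map (ℤ._+_ h) xs) ≡
                          2 * energy c xs + 2 * length xs * ∣ h ∣²
energy-shift h c []       = refl
energy-shift h c (x ∷ xs) = begin
  (∣ x ℤ.+ x ℤ.- (h ℤ.+ c) ∣² + E₁) + (∣ (h ℤ.+ x) ℤ.+ (h ℤ.+ x) ℤ.- (h ℤ.+ c) ∣² + E₂)
    ≡⟨ cong₂ (λ p q → (∣ p ∣² + E₁) + (∣ q ∣² + E₂)) (below x h c) (above x h c) ⟩
  (∣ y ℤ.- h ∣² + E₁) + (∣ y ℤ.+ h ∣² + E₂)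
    ≡⟨ interchange ∣ y ℤ.- h ∣² E₁ ∣ y ℤ.+ h ∣² E₂ ⟩
  (∣ y ℤ.- h ∣² + ∣ y ℤ.+ h ∣²) + (E₁ + E₂)
    ≡⟨ cong₂ _+_ (parallelogram y h) (energy-shift h c xs) ⟩
  (2 * ∣ y ∣² + 2 * ∣ h ∣²) + (2 * energy c xs + 2 * length xs * ∣ h ∣²)
    ≡⟨ collect ∣ y ∣² ∣ h ∣² (energy c xs) (length xs) ⟩
  2 * (∣ y ∣² + energy c xs) + 2 * suc (length xs) * ∣ h ∣²
    ∎
  where
  open ≡-Reasoning
  y = x ℤ.+ x ℤ.- c
  E₁ = energy (h ℤ.+ c) xs
  E₂ = energy (h ℤ.+ c) (map (ℤ._+_ h) xs)
  below : ∀ x h c → x ℤ.+ x ℤ.- (h ℤ.+ c) ≡ (x ℤ.+ x ℤ.- c) ℤ.- h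
  below = ℤSolver.solve-∀
  above : ∀ x h c → (h ℤ.+ x) ℤ.+ (h ℤ.+ x) ℤ.- (h ℤ.+ c) ≡ (x ℤ.+ x ℤ.- c) ℤ.+ h
  above = ℤSolver.solve-∀
  interchange : ∀ p e q f → (p + e) + (q + f) ≡ (p + q) + (e + f)
  interchange = ℕSolver.solve-∀
  collect : ∀ Y H E l → (2 * Y + 2 * H) + (2 * E + 2 * l * H) ≡ 2 * (Y + E) + 2 * suc l * H
  collect = ℕSolver.solve-∀

total : List ℤ → ℤ
total = foldr ℤ._+_ 0ℤ

sumOfSquares : List ℤ → ℕ
sumOfSquares hs = sum (map ∣_∣² hs)

energy-subsetSums : ∀ hs → energy (total hs) (subsetSums hs) ≡ 2 ^ length hs * sumOfSquares hs
energy-subsetSums []       = refl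
energy-subsetSums (h ∷ hs) = begin
  energy (h ℤ.+ total hs) (L ++ map (ℤ._+_ h) L)
    ≡⟨ energy-++ _ L _ ⟩
  energy (h ℤ.+ total hs) L + energy (h ℤ.+ total hs) (map (ℤ._+_ h) L)
    ≡⟨ energy-shift h (total hs) L ⟩
  2 * energy (total hs) L + 2 * length L * ∣ h ∣²
    ≡⟨ cong₂ (λ E l → 2 * E + 2 * l * ∣ h ∣²) (energy-subsetSums hs) (length-subsetSums hs) ⟩
  2 * (2 ^ length hs * sumOfSquares hs) + 2 * 2 ^ length hs * ∣ h ∣²
    ≡⟨ collect (2 ^ length hs) (sumOfSquares hs) ∣ h ∣² ⟩
  2 * 2 ^ length hs * (∣ h ∣² + sumOfSquares hs)
    ∎
  where
  open ≡-Reasoning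
  L = subsetSums hs
  collect : ∀ N Q H → 2 * (N * Q) + 2 * N * H ≡ 2 * N * (H + Q)
  collect = ℕSolver.solve-∀

sumOfSquares≤ : ∀ {Δ} hs → All (λ h → ℤ.∣ h ∣ ≤ Δ) hs → sumOfSquares hs ≤ length hs * Δ ^ 2
sumOfSquares≤ []       []           = z≤n
sumOfSquares≤ (h ∷ hs) (h≤Δ ∷ hs≤Δ) = ℕP.+-mono-≤ (ℕP.^-monoˡ-≤ 2 h≤Δ) (sumOfSquares≤ hs hs≤Δ)

InWindow : ℤ → ℕ → ℤ → Set
InWindow lo K x = lo ℤ.≤ x × x ℤ.< lo ℤ.+ ℤ.+ K

unique⇒length≤suc-filter≢ : ∀ y {xs : List ℤ} → Unique xs →
                            length xs ≤ suc (length (filter (λ x → ¬? (x ℤP.≟ y)) xs))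
unique⇒length≤suc-filter≢ y {[]}     _          = z≤n
unique⇒length≤suc-filter≢ y {x ∷ xs} (x∉xs ∷ u) with x ℤP.≟ y
... | yes refl = s≤s (ℕP.≤-reflexive (cong length (sym (filter-all (λ x → ¬? (x ℤP.≟ y)) xs≢y))))
  where xs≢y = All.map (λ y≢x x≡y → y≢x (sym x≡y)) x∉xs
... | no _     = s≤s (unique⇒length≤suc-filter≢ y u)

unique-window-length : ∀ K lo {xs : List ℤ} → Unique xs → All (InWindow lo K) xs → length xs ≤ K
unique-window-length zero    lo {[]}    _ _                       = z≤n
unique-window-length zero    lo {x ∷ _} _ ((lo≤x , x<lo+0) ∷ _) =
  ⊥-elim (ℤP.≤⇒≯ lo≤x (subst (x ℤ.<_) (ℤP.+-identityʳ lo) x<lo+0))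
unique-window-length (suc K) lo {xs} u inWindow =
  ℕP.≤-trans (unique⇒length≤suc-filter≢ lo u)
             (s≤s (unique-window-length K (ℤ.suc lo) (UniqueP.filter⁺ ≢lo? u)
                     (All.zipWith shrink (AllP.all-filter ≢lo? xs , AllP.filter⁺ ≢lo? inWindow))))
  where
  ≢lo? = λ x → ¬? (x ℤP.≟ lo)
  shift : ∀ lo K → lo ℤ.+ (ℤ.+ 1 ℤ.+ K) ≡ (ℤ.+ 1 ℤ.+ lo) ℤ.+ K
  shift = ℤSolver.solve-∀
  shrink : ∀ {x} → x ≢ lo × InWindow lo (suc K) x → InWindow (ℤ.suc lo) K x
  shrink (x≢lo , lo≤x , x<lo+1+K) =
    ℤP.i<j⇒suc[i]≤j (ℤP.≤∧≢⇒< lo≤x (x≢lo ∘ sym)) , subst (_ ℤ.<_) (shift lo (ℤ.+ K)) x<lo+1+K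

≤⇒≡+∣-∣ : ∀ {i j} → i ℤ.≤ j → j ≡ i ℤ.+ ℤ.+ ℤ.∣ j ℤ.- i ∣
≤⇒≡+∣-∣ {i} {j} i≤j =
  trans (sym (cancel i j)) (cong (ℤ._+_ i) (sym (ℤP.0≤i⇒+∣i∣≡i (ℤP.i≤j⇒0≤j-i i≤j))))
  where
  cancel : ∀ i j → i ℤ.+ (j ℤ.- i) ≡ j
  cancel = ℤSolver.solve-∀

central? : ∀ c K x → Dec (ℤ.∣ x ℤ.+ x ℤ.- c ∣ < K)
central? c K x = ℤ.∣ x ℤ.+ x ℤ.- c ∣ ℕP.<? K

-- |2x − c| < K says (c − K)/2 < x < (c − K)/2 + K, and q + 1 is the least integer above (c − K)/2.
central⇒inWindow : ∀ {x c K q r} → r ≤ 1 → c ≡ ℤ.+ r ℤ.+ q ℤ.* ℤ.+ 2 ℤ.+ ℤ.+ K →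
                   ℤ.∣ x ℤ.+ x ℤ.- c ∣ < K → InWindow (ℤ.suc q) K x
central⇒inWindow {x} {_} {K} {q} {r} r≤1 refl central = lower , upper
  where
  dev : ℤ → ℤ → ℕ
  dev q x = ℤ.∣ x ℤ.+ x ℤ.- (ℤ.+ r ℤ.+ q ℤ.* ℤ.+ 2 ℤ.+ ℤ.+ K) ∣
  not-far : ∀ {w} → dev q x ≢ K + w
  not-far {w} far = ℕP.<⇒≱ central (subst (K ≤_) (sym far) (ℕP.m≤m+n K w))
  lower : ℤ.suc q ℤ.≤ x
  lower with q ℤ.<? x
  ... | yes q<x = ℤP.i<j⇒suc[i]≤j q<x
  ... | no q≮x  = ⊥-elim (not-far (begin
      dev q x                              ≡⟨ cong (λ q → dev q x) (≤⇒≡+∣-∣ (ℤP.≮⇒≥ q≮x)) ⟩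
      dev (x ℤ.+ ℤ.+ k) x                  ≡⟨ cong ℤ.∣_∣ (below x (ℤ.+ k) (ℤ.+ r) (ℤ.+ K)) ⟩
      ℤ.∣ ℤ.- ℤ.+ (K + (r + (k + k))) ∣    ≡⟨ ℤP.∣-i∣≡∣i∣ (ℤ.+ (K + (r + (k + k)))) ⟩
      K + (r + (k + k))                    ∎))
    where
    open ≡-Reasoning
    k = ℤ.∣ q ℤ.- x ∣
    below : ∀ x k r K → x ℤ.+ x ℤ.- (r ℤ.+ (x ℤ.+ k) ℤ.* ℤ.+ 2 ℤ.+ K) ≡
                        ℤ.- (K ℤ.+ (r ℤ.+ (k ℤ.+ k)))
    below = ℤSolver.solve-∀
  upper : x ℤ.< ℤ.suc q ℤ.+ ℤ.+ K
  upper with x ℤ.<? ℤ.suc q ℤ.+ ℤ.+ K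
  ... | yes x<hi = x<hi
  ... | no x≮hi  = ⊥-elim (not-far (begin
      dev q x                                                ≡⟨ cong (dev q) (≤⇒≡+∣-∣ (ℤP.≮⇒≥ x≮hi)) ⟩
      dev q (ℤ.suc q ℤ.+ ℤ.+ K ℤ.+ ℤ.+ k)                    ≡⟨ cong ℤ.∣_∣ (above q (ℤ.+ k) (ℤ.+ r) (ℤ.+ K)) ⟩
      ℤ.∣ ℤ.+ K ℤ.+ ((ℤ.+ 2 ℤ.- ℤ.+ r) ℤ.+ ℤ.+ (k + k)) ∣
        ≡⟨ cong (λ w → ℤ.∣ ℤ.+ K ℤ.+ (w ℤ.+ ℤ.+ (k + k)) ∣) (2-r r≤1) ⟩
      K + ((2 ∸ r) + (k + k))                                ∎))
    where
    open ≡-Reasoning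
    k = ℤ.∣ x ℤ.- (ℤ.suc q ℤ.+ ℤ.+ K) ∣
    above : ∀ q k r K → let x = (ℤ.+ 1 ℤ.+ q ℤ.+ K) ℤ.+ k in
            x ℤ.+ x ℤ.- (r ℤ.+ q ℤ.* ℤ.+ 2 ℤ.+ K) ≡ K ℤ.+ ((ℤ.+ 2 ℤ.- r) ℤ.+ (k ℤ.+ k))
    above = ℤSolver.solve-∀
    2-r : ∀ {r} → r ≤ 1 → ℤ.+ 2 ℤ.- ℤ.+ r ≡ ℤ.+ (2 ∸ r)
    2-r z≤n       = refl
    2-r (s≤s z≤n) = refl

energy≥K²*#noncentral : ∀ c K xs → K ^ 2 * length xs ≤ energy c xs + K ^ 2 * length (filter (central? c K) xs)
energy≥K²*#noncentral c K []       = ℕP.≤-refl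
energy≥K²*#noncentral c K (x ∷ xs) with central? c K x
... | yes central = begin
  K ^ 2 * suc (length xs)                    ≡⟨ ℕP.*-suc (K ^ 2) (length xs) ⟩
  K ^ 2 + K ^ 2 * length xs                  ≤⟨ ℕP.+-monoʳ-≤ (K ^ 2) (energy≥K²*#noncentral c K xs) ⟩
  K ^ 2 + (E + K ^ 2 * F)                    ≤⟨ ℕP.m≤n+m _ Y ⟩
  Y + (K ^ 2 + (E + K ^ 2 * F))              ≡⟨ regroup Y (K ^ 2) E F ⟩
  (Y + E) + K ^ 2 * suc F
    ≡⟨ cong (λ l → (Y + E) + K ^ 2 * length l) (filter-accept (central? c K) central) ⟨
  (Y + E) + K ^ 2 * length (filter (central? c K) (x ∷ xs)) ∎
  where
  open ℕP.≤-Reasoning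
  Y = ∣ x ℤ.+ x ℤ.- c ∣²
  E = energy c xs
  F = length (filter (central? c K) xs)
  regroup : ∀ Y k E F → Y + (k + (E + k * F)) ≡ (Y + E) + k * suc F
  regroup = ℕSolver.solve-∀
... | no ¬central = begin
  K ^ 2 * suc (length xs)                    ≡⟨ ℕP.*-suc (K ^ 2) (length xs) ⟩
  K ^ 2 + K ^ 2 * length xs
    ≤⟨ ℕP.+-mono-≤ (ℕP.^-monoˡ-≤ 2 (ℕP.≮⇒≥ ¬central)) (energy≥K²*#noncentral c K xs) ⟩
  Y + (E + K ^ 2 * F)                        ≡⟨ ℕP.+-assoc Y E (K ^ 2 * F) ⟨
  (Y + E) + K ^ 2 * F
    ≡⟨ cong (λ l → (Y + E) + K ^ 2 * length l) (filter-reject (central? c K) ¬central) ⟨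
  (Y + E) + K ^ 2 * length (filter (central? c K) (x ∷ xs)) ∎
  where
  open ℕP.≤-Reasoning
  Y = ∣ x ℤ.+ x ℤ.- c ∣²
  E = energy c xs
  F = length (filter (central? c K) xs)

energy-lowerBound : ∀ c K {xs} → Unique xs → K ^ 2 * (length xs ∸ K) ≤ energy c xs
energy-lowerBound c K {xs} u = begin
  K ^ 2 * (length xs ∸ K)               ≡⟨ ℕP.*-distribˡ-∸ (K ^ 2) (length xs) K ⟩
  K ^ 2 * length xs ∸ K ^ 2 * K         ≤⟨ ℕP.∸-monoˡ-≤ (K ^ 2 * K) K²*length≤ ⟩
  energy c xs + K ^ 2 * K ∸ K ^ 2 * K   ≡⟨ ℕP.m+n∸n≡m (energy c xs) (K ^ 2 * K) ⟩
  energy c xs                           ∎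
  where
  open ℕP.≤-Reasoning
  r = (c ℤ.- ℤ.+ K) %ℕ 2
  q = (c ℤ.- ℤ.+ K) /ℕ 2
  addBack : ∀ c K → c ℤ.- K ℤ.+ K ≡ c
  addBack = ℤSolver.solve-∀
  c≡ : c ≡ ℤ.+ r ℤ.+ q ℤ.* ℤ.+ 2 ℤ.+ ℤ.+ K
  c≡ = trans (sym (addBack c (ℤ.+ K))) (cong (ℤ._+ ℤ.+ K) (a≡a%ℕn+[a/ℕn]*n (c ℤ.- ℤ.+ K) 2))
  #central≤K : length (filter (central? c K) xs) ≤ K
  #central≤K = unique-window-length K (ℤ.suc q) (UniqueP.filter⁺ (central? c K) u)
    (All.map (central⇒inWindow {q = q} {r = r} (ℕP.≤-pred (n%ℕd<d (c ℤ.- ℤ.+ K) 2)) c≡)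
             (AllP.all-filter (central? c K) xs))
  K²*length≤ : K ^ 2 * length xs ≤ energy c xs + K ^ 2 * K
  K²*length≤ = ℕP.≤-trans (energy≥K²*#noncentral c K xs)
                          (ℕP.+-monoʳ-≤ (energy c xs) (ℕP.*-monoʳ-≤ (K ^ 2) #central≤K))

unique-subsetSums⇒4^length≤8*sumOfSquares : ∀ hs → 0 < length hs → Unique (subsetSums hs) →
                                             4 ^ length hs ≤ 8 * sumOfSquares hs
unique-subsetSums⇒4^length≤8*sumOfSquares (h ∷ hs) _ unique = begin
  4 * 4 ^ t         ≡⟨ cong (4 *_) 4^t≡K² ⟩
  4 * K ^ 2         ≤⟨ ℕP.*-monoʳ-≤ 4 (ℕP.*-cancelˡ-≤ K {{ℕP.m^n≢0 2 t}} K³≤2KQ) ⟩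
  4 * (2 * Q)       ≡⟨ ℕP.*-assoc 4 2 Q ⟨
  8 * Q             ∎
  where
  open ℕP.≤-Reasoning
  t = length hs
  K = 2 ^ t
  Q = sumOfSquares (h ∷ hs)
  4^t≡K² : 4 ^ t ≡ K ^ 2
  4^t≡K² = trans (ℕP.^-*-assoc 2 2 t) (trans (cong (2 ^_) (ℕP.*-comm 2 t)) (sym (ℕP.^-*-assoc 2 t 2)))
  half : length (subsetSums (h ∷ hs)) ∸ K ≡ K
  half = trans (cong (_∸ K) (length-subsetSums (h ∷ hs))) (trans (ℕP.m+n∸m≡n K (K + 0)) (ℕP.+-identityʳ K))
  regroup : ∀ K Q → 2 * K * Q ≡ K * (2 * Q)
  regroup = ℕSolver.solve-∀
  K³≤2KQ : K * K ^ 2 ≤ K * (2 * Q)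
  K³≤2KQ = begin
    K * K ^ 2                                        ≡⟨ ℕP.*-comm K (K ^ 2) ⟩
    K ^ 2 * K                                        ≡⟨ cong (K ^ 2 *_) half ⟨
    K ^ 2 * (length (subsetSums (h ∷ hs)) ∸ K)       ≤⟨ energy-lowerBound (total (h ∷ hs)) K unique ⟩
    energy (total (h ∷ hs)) (subsetSums (h ∷ hs))    ≡⟨ energy-subsetSums (h ∷ hs) ⟩
    2 * K * Q                                        ≡⟨ regroup K Q ⟩
    K * (2 * Q)                                      ∎

lemma5 : (n : ℕ) (a : Fin n → ℤ) (b : ℤ) →
    ¬ (∀ i → a i ≡ 0ℤ) →
    (v : Fin n → ℚ) → IsVertex a b v →
    0 < suppSize v →
    10000 * 4 ^ suppSize v ≤ 123201 * suppSize v * normInf a ^ 2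
lemma5 n a b _ v vertex 0<s = begin
  10000 * 4 ^ s                      ≡⟨ cong (λ m → 10000 * 4 ^ m) len ⟨
  10000 * 4 ^ length hs              ≤⟨ ℕP.*-monoʳ-≤ 10000 4^s≤8Q ⟩
  10000 * (8 * sumOfSquares hs)      ≤⟨ ℕP.*-monoʳ-≤ 10000 (ℕP.*-monoʳ-≤ 8 Q≤sΔ²) ⟩
  10000 * (8 * (length hs * Δ ^ 2))  ≡⟨ cong (λ m → 10000 * (8 * (m * Δ ^ 2))) len ⟩
  10000 * (8 * (s * Δ ^ 2))          ≡⟨ ℕP.*-assoc 10000 8 (s * Δ ^ 2) ⟨
  80000 * (s * Δ ^ 2)                ≤⟨ ℕP.*-monoˡ-≤ (s * Δ ^ 2) (ℕP.m≤m+n 80000 43201) ⟩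
  123201 * (s * Δ ^ 2)               ≡⟨ ℕP.*-assoc 123201 s (Δ ^ 2) ⟨
  123201 * s * Δ ^ 2                 ∎
  where
  open ℕP.≤-Reasoning
  s = suppSize v
  Δ = normInf a
  hs = entriesOnSupp a v
  len = length-entriesOnSupp a v
  distinct = subsetSums-unique a v (vertex⇒subsetSumsInjective a b vertex)
  4^s≤8Q = unique-subsetSums⇒4^length≤8*sumOfSquares hs (subst (0 <_) (sym len) 0<s) distinct
  Q≤sΔ² = sumOfSquares≤ hs (entriesOnSupp-bounded a v)
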